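{- Let $G$ be a graph whose complement contains no copy of $K_{m,m}$, and let $H$ be a $(d+1,m,n)$-expander in $G$. Then $H$ is $d$-connected.
   Context: $m,d,n$ are positive integers. $N_G(S)$ is the set of vertices adjacent to some vertex of $S$. For an induced subgraph $H$ of a graph $G$, $H$ is a $(d,m,n)$-expander in $G$ if (i) $|N_H(S)|\ge d|S|$ for all $S\subseteq V(H)$ with $|S|<m$, and (ii) $|N_G(S)\cup S|\ge n$ for all $S\subseteq V(H)$ with $|S|\ge m$. Here $d$-connected means that $H$ remains connected after deleting any set of at most $d-1$ vertices. -}

module Defs where

open import Data.Nat using (ℕ; zero; suc; _<_; _≥_; _*_)
open import Data.Bool using (Bool; true; false; _∧_; _∨_)
open import Data.Fin using (Fin; zero; suc)
open import Data.Vec using (tabulate; lookup)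
open import Data.Fin.Subset using (Subset; _∈_; _∉_; _⊆_; _∩_; _∪_; _─_; ∣_∣)
open import Data.Product using (Σ; _×_)
open import Relation.Binary.PropositionalEquality using (_≡_)
open import Relation.Nullary using (¬_)

record Graph (N : ℕ) : Set where
  field
    adj   : Fin N → Fin N → Bool
    sym   : ∀ u v → adj u v ≡ adj v u
    irref : ∀ v → adj v v ≡ false
open Graph public

anyFin : ∀ {k} → (Fin k → Bool) → Bool
anyFin {zero}  f = false
anyFin {suc k} f = f zero ∨ anyFin (λ i → f (suc i))

N[_] : ∀ {N} → Graph N → Subset N → Subset N
N[ G ] S = tabulate (λ v → anyFin (λ u → lookup S u ∧ adj G u v))

-- N_H(S) for the induced subgraph H = G[W]: vertices of W adjacent to some vertex of S.
NInd[_,_] : ∀ {N} → Graph N → Subset N → Subset N → Subset N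
NInd[ G , W ] S = N[ G ] S ∩ W

ComplementHasKmm : ∀ {N} → Graph N → ℕ → Set
ComplementHasKmm {N} G m =
  Σ (Subset N) (λ A → Σ (Subset N) (λ B →
    (∣ A ∣ ≡ m) × (∣ B ∣ ≡ m) × (∀ v → v ∈ A → v ∉ B) ×
    (∀ a b → a ∈ A → b ∈ B → adj G a b ≡ false)))

IsExpander : ∀ {N} → Graph N → Subset N → ℕ → ℕ → ℕ → Set
IsExpander {N} G W d m n =
  (∀ S → S ⊆ W → ∣ S ∣ < m → ∣ NInd[ G , W ] S ∣ ≥ d * ∣ S ∣) ×
  (∀ S → S ⊆ W → ∣ S ∣ ≥ m → ∣ N[ G ] S ∪ S ∣ ≥ n)

data Reach {N : ℕ} (G : Graph N) (W : Subset N) : Fin N → Fin N → Set where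
  here : ∀ {u} → u ∈ W → Reach G W u u
  step : ∀ {u w v} → u ∈ W → adj G u w ≡ true → Reach G W w v → Reach G W u v

Connected : ∀ {N} → Graph N → Subset N → Set
Connected {N} G W = ∀ u v → u ∈ W → v ∈ W → Reach G W u v

DConnected : ∀ {N} → Graph N → Subset N → ℕ → Set
DConnected {N} G W d = ∀ X → X ⊆ W → ∣ X ∣ < d → Connected G (W ─ X)

-- Let |X| < d and suppose u, v lie in different components of H − X. A component C of H − X
-- has H-neighbourhood inside C ∪ X, so if |C| < m the (d+1)-expansion of H gives
-- (d+1)|C| ≤ |C| + |X|, i.e. d ≤ d|C| ≤ |X|, which is impossible. Hence the components of u
-- and of v have at least m vertices each, and m vertices from each span a K_{m,m} in the
-- complement of G.
module Submission where

open import Defs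
open import Data.Nat using (ℕ; _≤_; suc)
open import Data.Fin.Subset using (Subset)
open import Relation.Nullary using (¬_)

open import Data.Nat using (zero; _+_; _*_; _<_; _≥_; z≤n; s≤s; _≤?_)
open import Data.Nat.Properties
open import Data.Bool using (Bool; true; false; _∧_)
open import Data.Bool.Properties using (∧-conicalˡ; ∧-conicalʳ)
open import Data.Fin using (Fin; zero; suc)
open import Data.Vec using ([]; _∷_; lookup)
open import Data.Vec.Properties using (lookup∘tabulate; []=⇒lookup; lookup⇒[]=)
open import Data.Fin.Subset using (_∈_; _∉_; _⊆_; _∩_; _∪_; _─_; ∣_∣; ⁅_⁆; ⊥; inside; outside)
open import Data.Fin.Subset.Properties
open import Function using (_∘_)
open import Data.Product using (∃; _×_; _,_)
open import Data.Sum using (_⊎_; inj₁; inj₂)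
open import Relation.Nullary using (yes; no; contradiction)
open import Relation.Binary.PropositionalEquality using (_≡_; refl; trans; subst; cong)
  renaming (sym to ≡-sym)

∣p∪q∣≤∣p∣+∣q∣ : ∀ {n} (p q : Subset n) → ∣ p ∪ q ∣ ≤ ∣ p ∣ + ∣ q ∣
∣p∪q∣≤∣p∣+∣q∣ []            []            = z≤n
∣p∪q∣≤∣p∣+∣q∣ (inside ∷ p)  (inside ∷ q)  =
  s≤s (≤-trans (∣p∪q∣≤∣p∣+∣q∣ p q) (+-monoʳ-≤ ∣ p ∣ (n≤1+n ∣ q ∣)))
∣p∪q∣≤∣p∣+∣q∣ (inside ∷ p)  (outside ∷ q) = s≤s (∣p∪q∣≤∣p∣+∣q∣ p q)
∣p∪q∣≤∣p∣+∣q∣ (outside ∷ p) (inside ∷ q)  =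
  ≤-trans (s≤s (∣p∪q∣≤∣p∣+∣q∣ p q)) (≤-reflexive (≡-sym (+-suc ∣ p ∣ ∣ q ∣)))
∣p∪q∣≤∣p∣+∣q∣ (outside ∷ p) (outside ∷ q) = ∣p∪q∣≤∣p∣+∣q∣ p q

x∈p⇒1≤∣p∣ : ∀ {n x} {p : Subset n} → x ∈ p → 1 ≤ ∣ p ∣
x∈p⇒1≤∣p∣ {x = x} x∈p = subst (_≤ _) (∣⁅x⁆∣≡1 x)
  (p⊆q⇒∣p∣≤∣q∣ (λ y∈⁅x⁆ → subst (_∈ _) (≡-sym (x∈⁅y⁆⇒x≡y x y∈⁅x⁆)) x∈p))

p⊆q∧∣q∣≤∣p∣⇒q⊆p : ∀ {n} {p q : Subset n} → p ⊆ q → ∣ q ∣ ≤ ∣ p ∣ → q ⊆ p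
p⊆q∧∣q∣≤∣p∣⇒q⊆p {p = p} p⊆q ∣q∣≤∣p∣ {x} x∈q with x ∈? p
... | yes x∈p = x∈p
... | no  x∉p = contradiction ∣q∣≤∣p∣ (<⇒≱ (p⊂q⇒∣p∣<∣q∣ (p⊆q , x , x∈q , x∉p)))

∃-⊆-of-size : ∀ {n} m (p : Subset n) → m ≤ ∣ p ∣ → ∃ λ q → q ⊆ p × ∣ q ∣ ≡ m
∃-⊆-of-size {n} zero p _ = ⊥ , ⊥⊆ , ∣⊥∣≡0 n
∃-⊆-of-size (suc m) (inside ∷ p) (s≤s m≤∣p∣) with ∃-⊆-of-size m p m≤∣p∣
... | q , q⊆p , ∣q∣≡m = inside ∷ q , in⊆in q⊆p , cong suc ∣q∣≡m
∃-⊆-of-size (suc m) (outside ∷ p) m<∣p∣ with ∃-⊆-of-size (suc m) p m<∣p∣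
... | q , q⊆p , ∣q∣≡m = outside ∷ q , out⊆ q⊆p , ∣q∣≡m

module _ {n} (f : ℕ → Subset n) (f-mono : ∀ k → f k ⊆ f (suc k)) where

  private
    stabilised-or-∣f∣≥ : ∀ k → (∃ λ j → f (suc j) ⊆ f j) ⊎ k ≤ ∣ f k ∣
    stabilised-or-∣f∣≥ zero = inj₂ z≤n
    stabilised-or-∣f∣≥ (suc k) with stabilised-or-∣f∣≥ k
    ... | inj₁ stable = inj₁ stable
    ... | inj₂ k≤∣fk∣ with ∣ f (suc k) ∣ ≤? ∣ f k ∣
    ...   | yes shrinks = inj₁ (k , p⊆q∧∣q∣≤∣p∣⇒q⊆p (f-mono k) shrinks)
    ...   | no  grows   = inj₂ (≤-trans (s≤s k≤∣fk∣) (≰⇒> grows))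

  ascending-chain-stabilises : ∃ λ j → f (suc j) ⊆ f j
  ascending-chain-stabilises with stabilised-or-∣f∣≥ (suc n)
  ... | inj₁ stable = stable
  ... | inj₂ n<∣f∣  = contradiction n<∣f∣ (<⇒≱ (s≤s (∣p∣≤n (f (suc n)))))

anyFin⁻ : ∀ {k} (f : Fin k → Bool) → anyFin f ≡ true → ∃ λ i → f i ≡ true
anyFin⁻ {suc k} f any with f zero in f0
... | true  = zero , f0
... | false with anyFin⁻ (λ i → f (suc i)) any
...   | i , fi = suc i , fi

anyFin⁺ : ∀ {k} (f : Fin k → Bool) i → f i ≡ true → anyFin f ≡ true
anyFin⁺ f zero    fi rewrite fi = refl
anyFin⁺ f (suc i) fi rewrite anyFin⁺ (λ j → f (suc j)) i fi with f zero
... | true  = refl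
... | false = refl

module _ {N} (G : Graph N) where

  x∈N[S]⁻ : ∀ {S x} → x ∈ N[ G ] S → ∃ λ u → u ∈ S × adj G u x ≡ true
  x∈N[S]⁻ {S} {x} x∈NS with anyFin⁻ _ (trans (≡-sym (lookup∘tabulate _ x)) ([]=⇒lookup x∈NS))
  ... | u , e = u , lookup⇒[]= u S (∧-conicalˡ _ _ e) , ∧-conicalʳ (lookup S u) _ e

  x∈N[S]⁺ : ∀ {S x u} → u ∈ S → adj G u x ≡ true → x ∈ N[ G ] S
  x∈N[S]⁺ {S} {x} {u} u∈S ux = lookup⇒[]= x _ (trans (lookup∘tabulate _ x)
    (anyFin⁺ (λ w → lookup S w ∧ adj G w x) u
      (subst (λ b → b ∧ adj G u x ≡ true) (≡-sym ([]=⇒lookup u∈S)) ux)))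

  ComplementHasKmm⁺ : ∀ {m} (C D : Subset N) → m ≤ ∣ C ∣ → m ≤ ∣ D ∣ →
                      (∀ x → x ∈ C → x ∉ D) → (∀ a b → a ∈ C → b ∈ D → adj G a b ≡ false) →
                      ComplementHasKmm G m
  ComplementHasKmm⁺ {m} C D m≤∣C∣ m≤∣D∣ disjoint no-edge
    with ∃-⊆-of-size m C m≤∣C∣ | ∃-⊆-of-size m D m≤∣D∣
  ... | A , A⊆C , ∣A∣≡m | B , B⊆D , ∣B∣≡m =
    A , B , ∣A∣≡m , ∣B∣≡m , (λ x x∈A → disjoint x (A⊆C x∈A) ∘ B⊆D)
      , λ a b a∈A b∈B → no-edge a b (A⊆C a∈A) (B⊆D b∈B)

  module _ (W : Subset N) where

    Reach-snoc : ∀ {a b c} → Reach G W a b → adj G b c ≡ true → c ∈ W → Reach G W a c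
    Reach-snoc (here a∈W)         bc c∈W = step a∈W bc (here c∈W)
    Reach-snoc (step a∈W ab path) bc c∈W = step a∈W ab (Reach-snoc path bc c∈W)

    Reach-target∈ : ∀ {a b} → Reach G W a b → b ∈ W
    Reach-target∈ (here b∈W)     = b∈W
    Reach-target∈ (step _ _ path) = Reach-target∈ path

    Closed : Subset N → Set
    Closed S = ∀ {x y} → x ∈ S → y ∈ W → adj G x y ≡ true → y ∈ S

    Closed-Reach⁻ : ∀ {S} → Closed S → ∀ {a b} → Reach G W a b → b ∈ S → a ∈ S
    Closed-Reach⁻ closed (here _)                    b∈S = b∈S
    Closed-Reach⁻ closed (step {w = w} a∈W aw path) b∈S =
      closed (Closed-Reach⁻ closed path b∈S) a∈W (trans (Graph.sym G w _) aw)

    record Component (u : Fin N) : Set where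
      field
        vertices : Subset N
        root∈    : u ∈ vertices
        reach    : ∀ {x} → x ∈ vertices → Reach G W u x
        closed   : Closed vertices

    module _ {u} (u∈W : u ∈ W) where

      private
        ball : ℕ → Subset N
        ball zero    = ⁅ u ⁆
        ball (suc k) = ball k ∪ (N[ G ] (ball k) ∩ W)

        reach-ball : ∀ k {x} → x ∈ ball k → Reach G W u x
        reach-ball zero    x∈ rewrite x∈⁅y⁆⇒x≡y u x∈ = here u∈W
        reach-ball (suc k) x∈ with x∈p∪q⁻ (ball k) _ x∈
        ... | inj₁ x∈ball = reach-ball k x∈ball
        ... | inj₂ x∈N∩W with x∈p∩q⁻ _ W x∈N∩W
        ...   | x∈N , x∈W with x∈N[S]⁻ x∈N
        ...     | y , y∈ball , yx = Reach-snoc (reach-ball k y∈ball) yx x∈W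

        u∈ball : ∀ k → u ∈ ball k
        u∈ball zero    = x∈⁅x⁆ u
        u∈ball (suc k) = p⊆p∪q _ (u∈ball k)

      component : Component u
      component with ascending-chain-stabilises ball (λ k → p⊆p∪q _)
      ... | j , stable = record
        { vertices = ball j
        ; root∈    = u∈ball j
        ; reach    = reach-ball j
        ; closed   = λ x∈ y∈W xy → stable (x∈p∪q⁺ (inj₂ (x∈p∩q⁺ (x∈N[S]⁺ x∈ xy , y∈W))))
        }

    open Component

    separated-Components⇒ComplementHasKmm : ∀ {m u v} (Cu : Component u) (Cv : Component v) →
      v ∉ vertices Cu → m ≤ ∣ vertices Cu ∣ → m ≤ ∣ vertices Cv ∣ → ComplementHasKmm G m
    separated-Components⇒ComplementHasKmm Cu Cv v∉Cu m≤∣Cu∣ m≤∣Cv∣ =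
      ComplementHasKmm⁺ (vertices Cu) (vertices Cv) m≤∣Cu∣ m≤∣Cv∣ disjoint no-edge
      where
      disjoint : ∀ x → x ∈ vertices Cu → x ∉ vertices Cv
      disjoint x x∈Cu x∈Cv = v∉Cu (Closed-Reach⁻ (closed Cu) (reach Cv x∈Cv) x∈Cu)

      no-edge : ∀ a b → a ∈ vertices Cu → b ∈ vertices Cv → adj G a b ≡ false
      no-edge a b a∈Cu b∈Cv with adj G a b in ab
      ... | false = refl
      ... | true  = contradiction b∈Cv
        (disjoint b (closed Cu a∈Cu (Reach-target∈ (reach Cv b∈Cv)) ab))

    large-Components⇒Connected : ∀ {m} → ¬ ComplementHasKmm G m →
      (∀ {z} (C : Component z) → m ≤ ∣ vertices C ∣) → Connected G W
    large-Components⇒Connected no-Kmm large u v u∈W v∈W =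
      reach-or-separated (component u∈W) (component v∈W)
      where
      reach-or-separated : Component u → Component v → Reach G W u v
      reach-or-separated Cu Cv with v ∈? vertices Cu
      ... | yes v∈Cu = reach Cu v∈Cu
      ... | no  v∉Cu = contradiction
        (separated-Components⇒ComplementHasKmm Cu Cv v∉Cu (large Cu) (large Cv)) no-Kmm

  Closed-NInd⊆ : ∀ {W X S} → Closed (W ─ X) S → NInd[ G , W ] S ⊆ S ∪ X
  Closed-NInd⊆ {W} {X} closed {y} y∈NH with x∈p∩q⁻ _ W y∈NH | y ∈? X
  ... | _         | yes y∈X = x∈p∪q⁺ (inj₂ y∈X)
  ... | y∈N , y∈W | no  y∉X with x∈N[S]⁻ y∈N
  ...   | x , x∈S , xy = x∈p∪q⁺ (inj₁ (closed x∈S (x∈p∧x∉q⇒x∈p─q y∈W y∉X) xy))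

  Closed-small⇒d≤∣X∣ : ∀ {W X S d m} →
    (∀ S → S ⊆ W → ∣ S ∣ < m → ∣ NInd[ G , W ] S ∣ ≥ suc d * ∣ S ∣) →
    S ⊆ W → Closed (W ─ X) S → 1 ≤ ∣ S ∣ → ∣ S ∣ < m → d ≤ ∣ X ∣
  Closed-small⇒d≤∣X∣ {W} {X} {S} {d} expand S⊆W closed 1≤∣S∣ ∣S∣<m = begin
    d             ≡⟨ *-identityʳ d ⟨
    d * 1         ≤⟨ *-monoʳ-≤ d 1≤∣S∣ ⟩
    d * ∣ S ∣     ≤⟨ +-cancelˡ-≤ ∣ S ∣ _ _ (begin
      suc d * ∣ S ∣          ≤⟨ expand S S⊆W ∣S∣<m ⟩
      ∣ NInd[ G , W ] S ∣    ≤⟨ p⊆q⇒∣p∣≤∣q∣ (Closed-NInd⊆ closed) ⟩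
      ∣ S ∪ X ∣              ≤⟨ ∣p∪q∣≤∣p∣+∣q∣ S X ⟩
      ∣ S ∣ + ∣ X ∣          ∎) ⟩
    ∣ X ∣         ∎
    where open ≤-Reasoning

  Component-size≥ : ∀ {W X d m u} →
    (∀ S → S ⊆ W → ∣ S ∣ < m → ∣ NInd[ G , W ] S ∣ ≥ suc d * ∣ S ∣) → ∣ X ∣ < d →
    (C : Component (W ─ X) u) → m ≤ ∣ Component.vertices C ∣
  Component-size≥ {W} {X} expand ∣X∣<d C = ≮⇒≥ λ ∣C∣<m →
    <⇒≱ ∣X∣<d (Closed-small⇒d≤∣X∣ expand C⊆W closed (x∈p⇒1≤∣p∣ root∈) ∣C∣<m)
    where
    open Component C
    C⊆W : vertices ⊆ W
    C⊆W x∈C = p─q⊆p W X (Reach-target∈ (W ─ X) (reach x∈C))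

-- Only the small-set expansion (i) is used; condition (ii) and the bounds 1 ≤ d, m, n are not.
lemma3p3 : (d m n N : ℕ) → 1 ≤ d → 1 ≤ m → 1 ≤ n →
    (G : Graph N) → ¬ ComplementHasKmm G m →
    (W : Subset N) → IsExpander G W (suc d) m n →
    DConnected G W d
lemma3p3 d m n N _ _ _ G no-Kmm W (expand , _) X _ ∣X∣<d =
  large-Components⇒Connected G (W ─ X) no-Kmm (Component-size≥ G expand ∣X∣<d)
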